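{- For any integer $l\ge1$ and any finite graph $H$, the number of distinct edges of $H$ that belong to some irreducible $l$-coil of $H$ is at most $l\cdot\#_c(H)$.
   Context: An $l$-coil is a connected graph with at most $l$ edges containing at least two cycles. An $l$-coil in $H$ (a subgraph of $H$ that is an $l$-coil) is irreducible if no proper subset of its edges forms an $l$-coil. The cycle number $\#_c(H)$ of a graph with $k$ connected components, $v$ vertices and $e$ edges is $e+k-v$. -}

module Defs where

open import Data.Nat using (ℕ; _≤_; _+_; _∸_; _*_)
open import Data.Fin using (Fin; _≟_)
open import Data.Fin.Subset using (Subset; _∈_; _⊆_; _⊂_; _∩_; ∣_∣; ⊤)
open import Data.Vec using (tabulate)
open import Data.Bool using (_∨_)
open import Data.Product using (Σ; _×_; _,_; proj₁; proj₂; ∃; ∃-syntax)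
open import Data.Sum using (_⊎_)
open import Relation.Binary.PropositionalEquality using (_≡_; _≢_)
open import Relation.Nullary using (¬_)
open import Relation.Nullary.Decidable using (isYes)
open import Function.Bundles using (_⇔_)
open import Function.Definitions using (Surjective)

record Graph : Set where
  field
    n : ℕ
    m : ℕ
    ends : Fin m → Fin n × Fin n
    loopless : ∀ e → proj₁ (ends e) ≢ proj₂ (ends e)
    simple : ∀ e f →
      ((proj₁ (ends e) ≡ proj₁ (ends f) × proj₂ (ends e) ≡ proj₂ (ends f))
       ⊎ (proj₁ (ends e) ≡ proj₂ (ends f) × proj₂ (ends e) ≡ proj₁ (ends f)))
      → e ≡ f

module _ (H : Graph) where
  open Graph H

  Incident : Fin m → Fin n → Set
  Incident e v = proj₁ (ends e) ≡ v ⊎ proj₂ (ends e) ≡ v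

  incSet : Fin n → Subset m
  incSet v = tabulate (λ e → isYes (proj₁ (ends e) ≟ v) ∨ isYes (proj₂ (ends e) ≟ v))

  degIn : Subset m → Fin n → ℕ
  degIn D v = ∣ D ∩ incSet v ∣

  AdjIn : Subset m → Fin n → Fin n → Set
  AdjIn D u v = ∃[ e ] (e ∈ D × ((proj₁ (ends e) ≡ u × proj₂ (ends e) ≡ v)
                                ⊎ (proj₁ (ends e) ≡ v × proj₂ (ends e) ≡ u)))

  data Reach (D : Subset m) : Fin n → Fin n → Set where
    here : ∀ {v} → Reach D v v
    step : ∀ {u v w} → AdjIn D u v → Reach D v w → Reach D u w

  VertexOf : Subset m → Fin n → Set
  VertexOf D v = ∃[ e ] (e ∈ D × Incident e v)

  ConnectedEdges : Subset m → Set
  ConnectedEdges D = ∀ u v → VertexOf D u → VertexOf D v → Reach D u v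

  IsCycle : Subset m → Set
  IsCycle D = (∃[ e ] e ∈ D) × ConnectedEdges D
              × (∀ v → VertexOf D v → degIn D v ≡ 2)

  IsCoil : ℕ → Subset m → Set
  IsCoil l C = ConnectedEdges C × ∣ C ∣ ≤ l
             × ∃[ C₁ ] ∃[ C₂ ] (C₁ ⊆ C × C₂ ⊆ C × C₁ ≢ C₂ × IsCycle C₁ × IsCycle C₂)

  IsIrreducibleCoil : ℕ → Subset m → Set
  IsIrreducibleCoil l C = IsCoil l C × (∀ C' → C' ⊂ C → ¬ IsCoil l C')

  -- c labels the connected components of H bijectively by Fin k
  IsComponentLabelling : (k : ℕ) → (Fin n → Fin k) → Set
  IsComponentLabelling k c = Surjective _≡_ _≡_ c
                           × (∀ u v → (c u ≡ c v) ⇔ Reach ⊤ u v)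

  -- cycle number e + k - v, given the number k of components
  cycleNumber : ℕ → ℕ
  cycleNumber k = m + k ∸ n

-- Write S for the set of these edges and ν(D) for the number of vertices touched
-- by an edge set D.  The proof has two independent halves.
--
-- Build S as a union of irreducible coils, adding one
-- coil C at a time to the part U built so far.  The new edges E = C ∖ U are at
-- most l, and they bring strictly fewer than |E| new vertices: a new vertex has
-- two new edges (irreducible coils have no leaves, module Coils), and some vertex
-- has more new edges than that count requires (a vertex shared with U, or, if C
-- misses U, a branch vertex of C); the handshake lemma turns this into
-- 2·|new| < 2·|E|.  Hence |D| + l·ν(D) ≤ l·|D| survives each step and holds for S.
--
-- Vertices untouched by S are component roots or
-- have a parent edge (first edge of a shortest path to the root) outside S, and
-- distinct vertices have distinct parent edges; so |S| - ν(S) ≤ m + k - n.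
--
-- Together: |S| ≤ l·(|S| - ν(S)) ≤ l·#_c(H).
module Submission where

open import Defs
open import Data.Nat using (ℕ; _≤_; _*_)
open import Data.Fin using (Fin)
open import Data.Fin.Subset using (Subset; _∈_; ∣_∣)
open import Data.Product using (_×_; ∃-syntax)
open import Function.Bundles using (_⇔_)

open import Data.Nat using (zero; suc; _+_; _∸_; _<_; z≤n; s≤s; s≤s⁻¹)
open import Data.Nat.Properties
  using (+-*-semiring; +-identityʳ; +-suc; +-assoc; *-comm; *-suc; *-zeroʳ; *-identityʳ;
         *-distribˡ-+; m∸n+n≡m; m≤n+m∸n; ≤-refl; ≤-reflexive; ≤-trans; ≤-<-trans; <-≤-trans;
         ≤-pred; ≰⇒>; ≮⇒≥; n≮n; <-asym; _≤?_; +-mono-≤; +-monoˡ-≤; +-mono-<-≤; +-mono-≤-<;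
         *-monoʳ-≤; +-cancelˡ-≤; +-cancelʳ-≤; *-cancelˡ-<; module ≤-Reasoning)
open import Data.Nat.Tactic.RingSolver using (solve-∀)
open import Algebra.Properties.Semiring.Sum +-*-semiring
  using (sum; sum-cong-≗; sum-replicate-zero; ∑-distrib-+; ∑-comm; *-distribˡ-sum)
open import Data.Fin using (zero; suc; _≟_)
open import Data.Fin.Properties using (suc-injective; any?)
open import Data.Fin.Subset using (_∉_; _⊆_; ⁅_⁆; ∁; _∩_; _∪_; _─_; _-_; ⊥; ⊤; inside; outside)
open import Data.Fin.Subset.Properties
  using (_∈?_; ⊥⊆; ∉⊥; ∈⊤; ⊆-antisym; Empty-unique; ∣⊥∣≡0; ∣⊤∣≡n; ∣p∣≤n; ∣∁p∣≡n∸∣p∣;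
         x∈⁅x⁆; ∣⁅x⁆∣≡1; x∉p⇒x∈∁p; x∈∁p⇒x∉p; x∈p∩q⁺; x∈p∩q⁻; x∈p∪q⁻; p⊆p∪q; q⊆p∪q;
         ∣q∣≤∣p∪q∣; x∈p∧x∉q⇒x∈p─q; p─q⊆p; x∈p∧x≢y⇒x∈p-y; x∈p⇒p-x⊂p; x∈p⇒∣p-x∣<∣p∣;
         p⊆q⇒∣p∣≤∣q∣; p⊂q⇒∣p∣<∣q∣)
open import Data.Vec using ([]; _∷_; lookup; tabulate; here; there)
open import Data.Vec.Properties using (lookup-zipWith; lookup∘tabulate; lookup⇒[]=; []=⇒lookup)
open import Data.Bool using (Bool; true; false; _∧_; _∨_)
open import Data.Product using (_,_; proj₁; proj₂)
open import Data.Sum using (_⊎_; inj₁; inj₂)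
open import Data.Empty using (⊥-elim)
open import Data.List using (List; []; _∷_; allFin)
import Data.List.Membership.Propositional as List
open import Data.List.Membership.Propositional.Properties using (∈-allFin)
open import Data.List.Relation.Unary.Any using (here; there)
open import Function using (_∘_)
open import Function.Bundles using (Equivalence)
open import Relation.Nullary using (¬_; Dec; yes; no; _×-dec_; _⊎-dec_)
open import Relation.Nullary.Decidable using (isYes)
open import Relation.Unary using (Pred; Decidable)
open import Relation.Binary.PropositionalEquality
  using (_≡_; _≢_; refl; sym; trans; cong; cong₂; subst; module ≡-Reasoning)

∑-mono-≤ : ∀ {n} {f g : Fin n → ℕ} → (∀ i → f i ≤ g i) → sum f ≤ sum g
∑-mono-≤ {zero}  f≤g = z≤n
∑-mono-≤ {suc n} f≤g = +-mono-≤ (f≤g zero) (∑-mono-≤ (f≤g ∘ suc))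

∑-mono-< : ∀ {n} {f g : Fin n → ℕ} → (∀ i → f i ≤ g i) → ∃[ i ] f i < g i → sum f < sum g
∑-mono-< {suc n} f≤g (zero , f<g)  = +-mono-<-≤ f<g (∑-mono-≤ (λ i → f≤g (suc i)))
∑-mono-< {suc n} f≤g (suc i , f<g) = +-mono-≤-< (f≤g zero) (∑-mono-< (λ j → f≤g (suc j)) (i , f<g))

∑-single : ∀ {n} (f : Fin n → ℕ) (a : Fin n) → (∀ i → i ≢ a → f i ≡ 0) → sum f ≡ f a
∑-single {suc n} f zero vanish = begin
  f zero + sum (λ i → f (suc i))  ≡⟨ cong (f zero +_) (sum-cong-≗ (λ i → vanish (suc i) λ ())) ⟩
  f zero + sum {n} (λ _ → 0)      ≡⟨ cong (f zero +_) (sum-replicate-zero n) ⟩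
  f zero + 0                      ≡⟨ +-identityʳ (f zero) ⟩
  f zero                          ∎
  where open ≡-Reasoning
∑-single f (suc a) vanish = begin
  f zero + sum (λ i → f (suc i))  ≡⟨ cong (_+ sum (λ i → f (suc i))) (vanish zero λ ()) ⟩
  sum (λ i → f (suc i))           ≡⟨ ∑-single (λ i → f (suc i)) a (λ i i≢a → vanish (suc i) (λ eq → i≢a (suc-injective eq))) ⟩
  f (suc a)                       ∎
  where open ≡-Reasoning

𝟙 : Bool → ℕ
𝟙 true  = 1
𝟙 false = 0

χ : ∀ {n} → Subset n → Fin n → ℕ
χ p i = 𝟙 (lookup p i)

∣p∣≡∑χ : ∀ {n} (p : Subset n) → ∣ p ∣ ≡ sum (χ p)
∣p∣≡∑χ []            = refl
∣p∣≡∑χ (inside ∷ p)  = cong suc (∣p∣≡∑χ p)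
∣p∣≡∑χ (outside ∷ p) = ∣p∣≡∑χ p

χ-∩ : ∀ {n} (p q : Subset n) i → χ (p ∩ q) i ≡ χ p i * χ q i
χ-∩ p q i rewrite lookup-zipWith _∧_ i p q with lookup p i
... | true  = sym (+-identityʳ _)
... | false = refl

χ-≤ : ∀ {n} {p : Subset n} {i a b} → (i ∈ p → a ≤ b) → a * χ p i ≤ b
χ-≤ {p = p} {i} {a} {b} bound with lookup p i in eq
... | true  = subst (_≤ b) (sym (*-identityʳ a)) (bound (lookup⇒[]= i p eq))
... | false = subst (_≤ b) (sym (*-zeroʳ a)) z≤n

χ-∉ : ∀ {n} {p : Subset n} {i} → i ∉ p → χ p i ≡ 0
χ-∉ {p = p} {i} i∉p with lookup p i in eq
... | true  = ⊥-elim (i∉p (lookup⇒[]= i p eq))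
... | false = refl

∣p∪q∣≡∣p∣+∣q─p∣ : ∀ {n} (p q : Subset n) → ∣ p ∪ q ∣ ≡ ∣ p ∣ + ∣ q ─ p ∣
∣p∪q∣≡∣p∣+∣q─p∣ []            []            = refl
∣p∪q∣≡∣p∣+∣q─p∣ (inside ∷ p)  (_ ∷ q)       = cong suc (∣p∪q∣≡∣p∣+∣q─p∣ p q)
∣p∪q∣≡∣p∣+∣q─p∣ (outside ∷ p) (inside ∷ q)  = trans (cong suc (∣p∪q∣≡∣p∣+∣q─p∣ p q)) (sym (+-suc _ _))
∣p∪q∣≡∣p∣+∣q─p∣ (outside ∷ p) (outside ∷ q) = ∣p∪q∣≡∣p∣+∣q─p∣ p q

∣∁p∣+∣p∣≡n : ∀ {n} (p : Subset n) → ∣ ∁ p ∣ + ∣ p ∣ ≡ n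
∣∁p∣+∣p∣≡n p = trans (cong (_+ ∣ p ∣) (∣∁p∣≡n∸∣p∣ p)) (m∸n+n≡m (∣p∣≤n p))

x∈p─q⇒x∉q : ∀ {n} {x : Fin n} (p q : Subset n) → x ∈ p ─ q → x ∉ q
x∈p─q⇒x∉q (_ ∷ p) (outside ∷ q) (there x∈) (there x∈q) = x∈p─q⇒x∉q p q x∈ x∈q
x∈p─q⇒x∉q (_ ∷ p) (inside ∷ q)  (there x∈) (there x∈q) = x∈p─q⇒x∉q p q x∈ x∈q

∈⇒0<∣p∣ : ∀ {n} {x : Fin n} {p : Subset n} → x ∈ p → 0 < ∣ p ∣
∈⇒0<∣p∣ x∈p = ≤-<-trans z≤n (x∈p⇒∣p-x∣<∣p∣ x∈p)

∈²⇒2≤∣p∣ : ∀ {n} {x y : Fin n} {p : Subset n} → x ∈ p → y ∈ p → x ≢ y → 2 ≤ ∣ p ∣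
∈²⇒2≤∣p∣ x∈p y∈p x≢y =
  ≤-trans (s≤s (∈⇒0<∣p∣ (x∈p∧x≢y⇒x∈p-y y∈p (λ y≡x → x≢y (sym y≡x))))) (x∈p⇒∣p-x∣<∣p∣ x∈p)

injection-≤ : ∀ {n M} (P : Subset n) (Q : Subset M) (f : ∀ {i} → i ∈ P → Fin M)
  → (∀ {i} (i∈P : i ∈ P) → f i∈P ∈ Q)
  → (∀ {i j} (i∈P : i ∈ P) (j∈P : j ∈ P) → f i∈P ≡ f j∈P → i ≡ j)
  → ∣ P ∣ ≤ ∣ Q ∣
injection-≤ []            Q f into inj = z≤n
injection-≤ (outside ∷ P) Q f into inj =
  injection-≤ P Q (λ i∈P → f (there i∈P)) (λ i∈P → into (there i∈P))
    (λ i∈P j∈P eq → suc-injective (inj (there i∈P) (there j∈P) eq))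
injection-≤ (inside ∷ P) Q f into inj = ≤-trans (s≤s rest) (x∈p⇒∣p-x∣<∣p∣ (into here))
  where
  -- the other members land in Q minus the image of the first one
  rest : ∣ P ∣ ≤ ∣ Q - f here ∣
  rest = injection-≤ P (Q - f here) (λ i∈P → f (there i∈P))
    (λ i∈P → x∈p∧x≢y⇒x∈p-y (into (there i∈P)) (λ eq → 0≢suc (inj here (there i∈P) (sym eq))))
    (λ i∈P j∈P eq → suc-injective (inj (there i∈P) (there j∈P) eq))
    where
    0≢suc : ∀ {n} {i : Fin n} → zero ≢ suc i
    0≢suc ()

⟦_⟧ : ∀ {n p} {P : Pred (Fin n) p} → Decidable P → Subset n
⟦ P? ⟧ = tabulate (λ i → isYes (P? i))

∈⟦⟧⁺ : ∀ {n p} {P : Pred (Fin n) p} {P? : Decidable P} {i} → P i → i ∈ ⟦ P? ⟧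
∈⟦⟧⁺ {P? = P?} {i} Pi = lookup⇒[]= i _ (trans (lookup∘tabulate _ i) (accept (P? i)))
  where
  accept : (d : Dec _) → isYes d ≡ true
  accept (yes _)  = refl
  accept (no ¬Pi) = ⊥-elim (¬Pi Pi)

∈⟦⟧⁻ : ∀ {n p} {P : Pred (Fin n) p} {P? : Decidable P} {i} → i ∈ ⟦ P? ⟧ → P i
∈⟦⟧⁻ {P? = P?} {i} i∈ = extract (P? i) (trans (sym (lookup∘tabulate _ i)) ([]=⇒lookup i∈))
  where
  extract : (d : Dec _) → isYes d ≡ true → _
  extract (yes Pi) _ = Pi

least-witness : ∀ {p} {P : ℕ → Set p} → (∀ j → Dec (P j)) → ∀ {j} → P j
  → ∃[ h ] (P h × (∀ {i} → i < h → ¬ P i))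
least-witness P? {j} Pj with P? 0
... | yes P0 = 0 , P0 , λ ()
least-witness P? {zero}  Pj | no ¬P0 = ⊥-elim (¬P0 Pj)
least-witness P? {suc j} Pj | no ¬P0 with least-witness (λ i → P? (suc i)) Pj
... | h , Ph , below = suc h , Ph , λ { {zero} _ → ¬P0 ; {suc i} i<h → below (s≤s⁻¹ i<h) }

build-by-blocks : ∀ {m ℓ} (Inv : Subset m → Set ℓ) (S : Subset m) (B : ∀ {e} → e ∈ S → Subset m)
  → (∀ {e} (e∈S : e ∈ S) → e ∈ B e∈S × B e∈S ⊆ S)
  → Inv ⊥
  → (∀ {e} (e∈S : e ∈ S) {U} → e ∉ U → Inv U → Inv (U ∪ B e∈S))
  → Inv S
build-by-blocks {m} Inv S B block inv⊥ grow with covering (allFin m)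
  where
  Covering : List (Fin m) → Set _
  Covering es = ∃[ U ] (Inv U × U ⊆ S × (∀ {e} → e List.∈ es → e ∈ S → e ∈ U))

  covering : ∀ es → Covering es
  covering []       = ⊥ , inv⊥ , ⊥⊆ , λ ()
  covering (e ∷ es) with covering es
  ... | U , invU , U⊆S , covers with e ∈? S | e ∈? U
  ...   | no e∉S | _ = U , invU , U⊆S , λ { (here refl) e∈S → ⊥-elim (e∉S e∈S) ; (there e∈es) → covers e∈es }
  ...   | yes _ | yes e∈U = U , invU , U⊆S , λ { (here refl) _ → e∈U ; (there e∈es) → covers e∈es }
  ...   | yes e∈S | no e∉U = U ∪ B e∈S , grow e∈S e∉U invU , ∪⊆S , covers′
    where
    ∪⊆S : U ∪ B e∈S ⊆ S
    ∪⊆S x∈ with x∈p∪q⁻ U (B e∈S) x∈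
    ... | inj₁ x∈U = U⊆S x∈U
    ... | inj₂ x∈B = proj₂ (block e∈S) x∈B
    covers′ : ∀ {f} → f List.∈ e ∷ es → f ∈ S → f ∈ U ∪ B e∈S
    covers′ (here refl)   _   = q⊆p∪q U (B e∈S) (proj₁ (block e∈S))
    covers′ (there f∈es) f∈S = p⊆p∪q (B e∈S) (covers f∈es f∈S)
... | U , invU , U⊆S , covers = subst Inv (⊆-antisym U⊆S (λ {f} f∈S → covers (∈-allFin f) f∈S)) invU

module GraphFacts (H : Graph) where
  open Graph H

  Joins : Fin m → Fin n → Fin n → Set
  Joins e u w = (proj₁ (ends e) ≡ u × proj₂ (ends e) ≡ w) ⊎ (proj₁ (ends e) ≡ w × proj₂ (ends e) ≡ u)

  joins-sym : ∀ {e u w} → Joins e u w → Joins e w u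
  joins-sym (inj₁ ends≡) = inj₂ ends≡
  joins-sym (inj₂ ends≡) = inj₁ ends≡

  joins-incident : ∀ {e u w} → Joins e u w → Incident H e u
  joins-incident (inj₁ (p , _)) = inj₁ p
  joins-incident (inj₂ (_ , q)) = inj₂ q

  joins-endpoints : ∀ {e u w v} → Joins e u w → Incident H e v → v ≡ u ⊎ v ≡ w
  joins-endpoints (inj₁ (p , q)) (inj₁ r) = inj₁ (trans (sym r) p)
  joins-endpoints (inj₁ (p , q)) (inj₂ r) = inj₂ (trans (sym r) q)
  joins-endpoints (inj₂ (p , q)) (inj₁ r) = inj₂ (trans (sym r) p)
  joins-endpoints (inj₂ (p , q)) (inj₂ r) = inj₁ (trans (sym r) q)

  joins-other : ∀ {e u w w′} → Joins e u w → Joins e u w′ → w ≡ w′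
  joins-other (inj₁ (p , q)) (inj₁ (p′ , q′)) = trans (sym q) q′
  joins-other (inj₁ (p , q)) (inj₂ (p′ , q′)) = ⊥-elim (loopless _ (trans p (sym q′)))
  joins-other (inj₂ (p , q)) (inj₁ (p′ , q′)) = ⊥-elim (loopless _ (trans p′ (sym q)))
  joins-other (inj₂ (p , q)) (inj₂ (p′ , q′)) = trans (sym p) p′

  incident? : ∀ e v → Dec (Incident H e v)
  incident? e v = (proj₁ (ends e) ≟ v) ⊎-dec (proj₂ (ends e) ≟ v)

  vertexOf? : ∀ D v → Dec (VertexOf H D v)
  vertexOf? D v = any? (λ e → (e ∈? D) ×-dec incident? e v)

  incSet-lookup : ∀ e v → lookup (incSet H v) e ≡ isYes (proj₁ (ends e) ≟ v) ∨ isYes (proj₂ (ends e) ≟ v)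
  incSet-lookup e v = lookup∘tabulate _ e

  ∈incSet⁺ : ∀ {e v} → Incident H e v → e ∈ incSet H v
  ∈incSet⁺ {e} {v} inc = lookup⇒[]= e (incSet H v) (trans (incSet-lookup e v) (accept (proj₁ (ends e) ≟ v) (proj₂ (ends e) ≟ v) inc))
    where
    accept : ∀ {A B : Set} (a? : Dec A) (b? : Dec B) → A ⊎ B → isYes a? ∨ isYes b? ≡ true
    accept (yes _) _       _        = refl
    accept (no _)  (yes _) _        = refl
    accept (no ¬a) (no _)  (inj₁ a) = ⊥-elim (¬a a)
    accept (no _)  (no ¬b) (inj₂ b) = ⊥-elim (¬b b)

  ∈incSet⁻ : ∀ {e v} → e ∈ incSet H v → Incident H e v
  ∈incSet⁻ {e} {v} e∈ = extract (proj₁ (ends e) ≟ v) (proj₂ (ends e) ≟ v) (trans (sym (incSet-lookup e v)) ([]=⇒lookup e∈))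
    where
    extract : ∀ {A B : Set} (a? : Dec A) (b? : Dec B) → isYes a? ∨ isYes b? ≡ true → A ⊎ B
    extract (yes a) _       _ = inj₁ a
    extract (no _)  (yes b) _ = inj₂ b

  deg : Subset m → Fin n → ℕ
  deg = degIn H

  edgeAt : ∀ {D e v} → e ∈ D → Incident H e v → e ∈ D ∩ incSet H v
  edgeAt e∈D inc = x∈p∩q⁺ (e∈D , ∈incSet⁺ inc)

  edgesAt-mono : ∀ {D D′ v} → (∀ {f} → f ∈ D → Incident H f v → f ∈ D′) → D ∩ incSet H v ⊆ D′ ∩ incSet H v
  edgesAt-mono {D} {v = v} D⊆D′-at-v f∈ =
    let (f∈D , f∈inc) = x∈p∩q⁻ D (incSet H v) f∈ in x∈p∩q⁺ (D⊆D′-at-v f∈D (∈incSet⁻ f∈inc) , f∈inc)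

  deg-mono-at : ∀ {D D′ v} → (∀ {f} → f ∈ D → Incident H f v → f ∈ D′) → deg D v ≤ deg D′ v
  deg-mono-at D⊆D′-at-v = p⊆q⇒∣p∣≤∣q∣ (edgesAt-mono D⊆D′-at-v)

  deg-mono : ∀ {D D′} → D ⊆ D′ → ∀ v → deg D v ≤ deg D′ v
  deg-mono D⊆D′ v = deg-mono-at (λ f∈D _ → D⊆D′ f∈D)

  deg-strict : ∀ {D D′ e v} → D ⊆ D′ → e ∈ D′ → e ∉ D → Incident H e v → deg D v < deg D′ v
  deg-strict {D} {v = v} D⊆D′ e∈D′ e∉D inc = p⊂q⇒∣p∣<∣q∣
    (edgesAt-mono (λ f∈D _ → D⊆D′ f∈D) , _ , edgeAt e∈D′ inc , λ e∈ → e∉D (proj₁ (x∈p∩q⁻ D (incSet H v) e∈)))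

  vertex⇒0<deg : ∀ {D v} → VertexOf H D v → 0 < deg D v
  vertex⇒0<deg (e , e∈D , inc) = ∈⇒0<∣p∣ (edgeAt e∈D inc)

  deg-two : ∀ {D e f v} → e ∈ D → f ∈ D → e ≢ f → Incident H e v → Incident H f v → 2 ≤ deg D v
  deg-two e∈D f∈D e≢f e-inc f-inc = ∈²⇒2≤∣p∣ (edgeAt e∈D e-inc) (edgeAt f∈D f-inc) e≢f

  private
    ∑-point : ∀ (a : Fin n) → sum (λ v → 𝟙 (isYes (a ≟ v))) ≡ 1
    ∑-point a = trans (∑-single _ a (λ v v≢a → reject (a ≟ v) (λ a≡v → v≢a (sym a≡v)))) (accept (a ≟ a))
      where
      reject : ∀ {A : Set} (a? : Dec A) → ¬ A → 𝟙 (isYes a?) ≡ 0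
      reject (yes a) ¬a = ⊥-elim (¬a a)
      reject (no _)  _  = refl
      accept : (a? : Dec (a ≡ a)) → 𝟙 (isYes a?) ≡ 1
      accept (yes _)  = refl
      accept (no a≢a) = ⊥-elim (a≢a refl)

    -- since e is not a loop, its incidence with v is the sum of the incidences of its two ends
    incidence-split : ∀ e v → χ (incSet H v) e ≡ 𝟙 (isYes (proj₁ (ends e) ≟ v)) + 𝟙 (isYes (proj₂ (ends e) ≟ v))
    incidence-split e v rewrite incSet-lookup e v with proj₁ (ends e) ≟ v | proj₂ (ends e) ≟ v
    ... | yes p | yes q = ⊥-elim (loopless e (trans p (sym q)))
    ... | yes _ | no _  = refl
    ... | no _  | yes _ = refl
    ... | no _  | no _  = refl

  ∑-ends : ∀ e → sum (λ v → χ (incSet H v) e) ≡ 2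
  ∑-ends e = begin
    sum (λ v → χ (incSet H v) e)
      ≡⟨ sum-cong-≗ (incidence-split e) ⟩
    sum (λ v → 𝟙 (isYes (proj₁ (ends e) ≟ v)) + 𝟙 (isYes (proj₂ (ends e) ≟ v)))
      ≡⟨ ∑-distrib-+ (λ v → 𝟙 (isYes (proj₁ (ends e) ≟ v))) (λ v → 𝟙 (isYes (proj₂ (ends e) ≟ v))) ⟩
    sum (λ v → 𝟙 (isYes (proj₁ (ends e) ≟ v))) + sum (λ v → 𝟙 (isYes (proj₂ (ends e) ≟ v)))
      ≡⟨ cong₂ _+_ (∑-point (proj₁ (ends e))) (∑-point (proj₂ (ends e))) ⟩
    2 ∎
    where open ≡-Reasoning

  handshake : ∀ D → sum (deg D) ≡ 2 * ∣ D ∣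
  handshake D = begin
    sum (λ v → ∣ D ∩ incSet H v ∣)
      ≡⟨ sum-cong-≗ (λ v → trans (∣p∣≡∑χ (D ∩ incSet H v)) (sum-cong-≗ (χ-∩ D (incSet H v)))) ⟩
    sum (λ v → sum (λ e → χ D e * χ (incSet H v) e))
      ≡⟨ ∑-comm (λ v e → χ D e * χ (incSet H v) e) ⟩
    sum (λ e → sum (λ v → χ D e * χ (incSet H v) e))
      ≡⟨ sum-cong-≗ (λ e → trans (sym (*-distribˡ-sum (χ D e) (λ v → χ (incSet H v) e)))
                                 (trans (cong (χ D e *_) (∑-ends e)) (*-comm (χ D e) 2))) ⟩
    sum (λ e → 2 * χ D e)
      ≡⟨ sym (*-distribˡ-sum 2 (χ D)) ⟩
    2 * sum (χ D)
      ≡⟨ cong (2 *_) (sym (∣p∣≡∑χ D)) ⟩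
    2 * ∣ D ∣ ∎
    where open ≡-Reasoning

  walk-preserves : ∀ {D} (P : Fin n → Set) → (∀ {u w} → AdjIn H D u w → P u → P w)
    → ∀ {x y} → Reach H D x y → P x → P y
  walk-preserves P spread here         Px = Px
  walk-preserves P spread (step a walk) Px = walk-preserves P spread walk (spread a Px)

  touched : Subset m → Subset n
  touched D = ⟦ vertexOf? D ⟧

  ν : Subset m → ℕ
  ν D = ∣ touched D ∣

  touched⁺ : ∀ {D v} → VertexOf H D v → v ∈ touched D
  touched⁺ {D} = ∈⟦⟧⁺ {P? = vertexOf? D}

  touched⁻ : ∀ {D v} → v ∈ touched D → VertexOf H D v
  touched⁻ {D} = ∈⟦⟧⁻ {P? = vertexOf? D}

  ν-∅ : ν ⊥ ≡ 0
  ν-∅ = trans (cong ∣_∣ (Empty-unique λ (_ , v∈) → ∉⊥ (proj₁ (proj₂ (touched⁻ v∈))))) (∣⊥∣≡0 n)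

module Coils (H : Graph) where
  open Graph H
  open GraphFacts H

  cycle⇒2≤deg : ∀ {C C₁ v} → C₁ ⊆ C → IsCycle H C₁ → VertexOf H C₁ v → 2 ≤ deg C v
  cycle⇒2≤deg {C} {v = v} C₁⊆C (_ , _ , deg≡2) v∈C₁ = subst (_≤ deg C v) (deg≡2 v v∈C₁) (deg-mono C₁⊆C v)

  module Leaf {C : Subset m} {e : Fin m} {v : Fin n} (e∈C : e ∈ C) (e-at-v : Incident H e v)
              (only-e : ∀ {f} → f ∈ C → Incident H f v → f ≡ e) where

    leaf-deg : deg C v ≤ 1
    leaf-deg = ≤-trans (p⊆q⇒∣p∣≤∣q∣ in⁅e⁆) (≤-reflexive (∣⁅x⁆∣≡1 e))
      where
      in⁅e⁆ : C ∩ incSet H v ⊆ ⁅ e ⁆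
      in⁅e⁆ f∈ = let (f∈C , f∈inc) = x∈p∩q⁻ C (incSet H v) f∈
                 in subst (_∈ ⁅ e ⁆) (sym (only-e f∈C (∈incSet⁻ f∈inc))) (x∈⁅x⁆ e)

    vertex≢leaf : ∀ {u} → VertexOf H (C - e) u → u ≢ v
    vertex≢leaf (f , f∈ , f-inc) refl =
      x∈p─q⇒x∉q C ⁅ e ⁆ f∈ (subst (_∈ ⁅ e ⁆) (sym (only-e (p─q⊆p C ⁅ e ⁆ f∈) f-inc)) (x∈⁅x⁆ e))

    -- A C-walk between vertices other than the leaf can avoid e: it can only
    -- pass through the leaf by going along e and straight back.
    avoid-leaf : ∀ {x y} → Reach H C x y → x ≢ v → y ≢ v → Reach H (C - e) x y
    avoid-leaf here _ _ = here
    avoid-leaf (step {v = z} (f , f∈C , f-joins) walk) x≢v y≢v with z ≟ v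
    ... | no z≢v = step (f , x∈p∧x≢y⇒x∈p-y f∈C f≢e , f-joins) (avoid-leaf walk z≢v y≢v)
      where
      f≢e : f ≢ e
      f≢e refl with joins-endpoints f-joins e-at-v
      ... | inj₁ v≡x = x≢v (sym v≡x)
      ... | inj₂ v≡z = z≢v (sym v≡z)
    ... | yes refl with walk
    ...   | here = ⊥-elim (y≢v refl)
    ...   | step {v = w} (g , g∈C , g-joins) walk′ =
      subst (λ x′ → Reach H (C - e) x′ _) (sym x≡w) (avoid-leaf walk′ (λ w≡v → x≢v (trans x≡w w≡v)) y≢v)
      where
      x≡w : _ ≡ w
      x≡w = joins-other (subst (λ f′ → Joins f′ v _) (only-e f∈C (joins-incident (joins-sym f-joins))) (joins-sym f-joins))
                        (subst (λ g′ → Joins g′ v w) (only-e g∈C (joins-incident g-joins)) g-joins)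

    -- Cycles inside C avoid e, since the leaf has degree below 2.
    cycle-avoids-leaf : ∀ {C₁} → C₁ ⊆ C → IsCycle H C₁ → C₁ ⊆ C - e
    cycle-avoids-leaf C₁⊆C cyc {f} f∈C₁ = x∈p∧x≢y⇒x∈p-y (C₁⊆C f∈C₁) f≢e
      where
      f≢e : f ≢ e
      f≢e refl = n≮n 1 (≤-trans (cycle⇒2≤deg C₁⊆C cyc (f , f∈C₁ , e-at-v)) leaf-deg)

    remove-leaf : ∀ {l} → IsCoil H l C → IsCoil H l (C - e)
    remove-leaf (connected , size≤l , C₁ , C₂ , C₁⊆C , C₂⊆C , C₁≢C₂ , cyc₁ , cyc₂) =
        (λ u w u∈ w∈ → avoid-leaf (connected u w (widen u∈) (widen w∈)) (vertex≢leaf u∈) (vertex≢leaf w∈))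
      , ≤-trans (p⊆q⇒∣p∣≤∣q∣ (p─q⊆p C ⁅ e ⁆)) size≤l
      , C₁ , C₂ , cycle-avoids-leaf C₁⊆C cyc₁ , cycle-avoids-leaf C₂⊆C cyc₂ , C₁≢C₂ , cyc₁ , cyc₂
      where
      widen : ∀ {u} → VertexOf H (C - e) u → VertexOf H C u
      widen (f , f∈ , f-inc) = f , p─q⊆p C ⁅ e ⁆ f∈ , f-inc

  irreducible⇒2≤deg : ∀ {l C v} → IsIrreducibleCoil H l C → VertexOf H C v → 2 ≤ deg C v
  irreducible⇒2≤deg {C = C} {v} (coil , minimal) (e , e∈C , e-at-v) with 2 ≤? deg C v
  ... | yes 2≤deg = 2≤deg
  ... | no deg<2 = ⊥-elim (minimal (C - e) (x∈p⇒p-x⊂p e∈C) (Leaf.remove-leaf e∈C e-at-v only-e coil))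
    where
    only-e : ∀ {f} → f ∈ C → Incident H f v → f ≡ e
    only-e {f} f∈C f-at-v with f ≟ e
    ... | yes f≡e = f≡e
    ... | no f≢e = ⊥-elim (deg<2 (deg-two f∈C e∈C f≢e f-at-v e-at-v))

  cycle-fills : ∀ {C C₁} → ConnectedEdges H C → (∀ v → deg C v ≤ 2) → C₁ ⊆ C → IsCycle H C₁ → C ⊆ C₁
  cycle-fills {C} {C₁} connected deg≤2 C₁⊆C cyc {f} f∈C =
    saturated (walk-preserves (VertexOf H C₁) spread (connected _ _ start end) start₁) f∈C (inj₁ refl)
    where
    -- at a vertex of the cycle the degree is already used up, so every edge of C is in the cycle
    saturated : ∀ {u g} → VertexOf H C₁ u → g ∈ C → Incident H g u → g ∈ C₁
    saturated {u} {g} u∈C₁ g∈C g-at-u with g ∈? C₁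
    ... | yes g∈C₁ = g∈C₁
    ... | no g∉C₁ = ⊥-elim (n≮n 2 (≤-<-trans (cycle⇒2≤deg (λ x → x) cyc u∈C₁)
                                    (<-≤-trans (deg-strict C₁⊆C g∈C g∉C₁ g-at-u) (deg≤2 u))))
    spread : ∀ {u w} → AdjIn H C u w → VertexOf H C₁ u → VertexOf H C₁ w
    spread (g , g∈C , g-joins) u∈C₁ = g , saturated u∈C₁ g∈C (joins-incident g-joins) , joins-incident (joins-sym g-joins)
    e₁ = proj₁ (proj₁ cyc)
    start₁ : VertexOf H C₁ (proj₁ (ends e₁))
    start₁ = e₁ , proj₂ (proj₁ cyc) , inj₁ refl
    start : VertexOf H C (proj₁ (ends e₁))
    start = e₁ , C₁⊆C (proj₂ (proj₁ cyc)) , inj₁ refl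
    end : VertexOf H C (proj₁ (ends f))
    end = f , f∈C , inj₁ refl

  -- Every coil has a branch vertex, of degree at least 3: otherwise each of its
  -- two cycles would be the whole coil.
  coil⇒branch : ∀ {l C} → IsCoil H l C → ∃[ v ] 3 ≤ deg C v
  coil⇒branch {C = C} (connected , _ , C₁ , C₂ , C₁⊆C , C₂⊆C , C₁≢C₂ , cyc₁ , cyc₂)
    with any? (λ v → 3 ≤? deg C v)
  ... | yes branch = branch
  ... | no none = ⊥-elim (C₁≢C₂ (trans (whole C₁⊆C cyc₁) (sym (whole C₂⊆C cyc₂))))
    where
    deg≤2 : ∀ v → deg C v ≤ 2
    deg≤2 v = ≤-pred (≰⇒> (λ 3≤deg → none (v , 3≤deg)))
    whole : ∀ {C₁} → C₁ ⊆ C → IsCycle H C₁ → C₁ ≡ C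
    whole C₁⊆C cyc = ⊆-antisym C₁⊆C (cycle-fills connected deg≤2 C₁⊆C cyc)

block-balance : ∀ {l b new} → b ≤ l → new < b → b + l * new ≤ l * b
block-balance {l} {b} {new} b≤l new<b = begin
  b + l * new  ≤⟨ +-monoˡ-≤ (l * new) b≤l ⟩
  l + l * new  ≡⟨ *-suc l new ⟨
  l * suc new  ≤⟨ *-monoʳ-≤ l new<b ⟩
  l * b        ∎
  where open ≤-Reasoning

module Growth (H : Graph) (l : ℕ) where
  open Graph H
  open GraphFacts H
  open Coils H

  -- D is sparse when |D| + l·ν(D) ≤ l·|D|, i.e. |D| ≤ l·(|D| - ν D).
  Sparse : Subset m → Set
  Sparse D = ∣ D ∣ + l * ν D ≤ l * ∣ D ∣

  sparse-∅ : Sparse ⊥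
  sparse-∅ rewrite ∣⊥∣≡0 m | ν-∅ | *-zeroʳ l = z≤n

  module Step {U C : Subset m} {e : Fin m} (irr : IsIrreducibleCoil H l C) (e∈C : e ∈ C) (e∉U : e ∉ U) where

    E : Subset m
    E = C ─ U

    new : Subset n
    new = touched E ─ touched U

    E⊆C : E ⊆ C
    E⊆C = p─q⊆p C U

    E≤l : ∣ E ∣ ≤ l
    E≤l = ≤-trans (p⊆q⇒∣p∣≤∣q∣ E⊆C) (proj₁ (proj₂ (proj₁ irr)))

    size-∪ : ∣ U ∪ C ∣ ≡ ∣ U ∣ + ∣ E ∣
    size-∪ = ∣p∪q∣≡∣p∣+∣q─p∣ U C

    ν-∪ : ν (U ∪ C) ≤ ν U + ∣ new ∣
    ν-∪ = ≤-trans (p⊆q⇒∣p∣≤∣q∣ touched-∪) (≤-reflexive (∣p∪q∣≡∣p∣+∣q─p∣ (touched U) (touched E)))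
      where
      touched-∪ : touched (U ∪ C) ⊆ touched U ∪ touched E
      touched-∪ v∈ with touched⁻ v∈
      ... | f , f∈U∪C , f-at-v with f ∈? U | x∈p∪q⁻ U C f∈U∪C
      ...   | yes f∈U | _        = p⊆p∪q (touched E) (touched⁺ (f , f∈U , f-at-v))
      ...   | no _    | inj₁ f∈U = p⊆p∪q (touched E) (touched⁺ (f , f∈U , f-at-v))
      ...   | no f∉U  | inj₂ f∈C = q⊆p∪q (touched U) (touched E) (touched⁺ (f , x∈p∧x∉q⇒x∈p─q f∈C f∉U , f-at-v))

    untouched⇒C⊆E : ∀ {v f} → v ∉ touched U → f ∈ C → Incident H f v → f ∈ E
    untouched⇒C⊆E v∉ f∈C f-at-v = x∈p∧x∉q⇒x∈p─q f∈C (λ f∈U → v∉ (touched⁺ (_ , f∈U , f-at-v)))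

    -- A new vertex is a vertex of C untouched by U, so it has at least two new edges.
    new⇒2≤deg : ∀ {v} → v ∈ new → 2 ≤ deg E v
    new⇒2≤deg {v} v∈new with touched⁻ (p─q⊆p (touched E) (touched U) v∈new)
    ... | f , f∈E , f-at-v =
      ≤-trans (irreducible⇒2≤deg irr (f , E⊆C f∈E , f-at-v)) (deg-mono-at (untouched⇒C⊆E v∉U))
      where
      v∉U : v ∉ touched U
      v∉U = x∈p─q⇒x∉q (touched E) (touched U) v∈new

    -- Some vertex has more new edges than twice its newness: either the new
    -- edges meet U at a vertex, or C is disjoint from U and its branch vertex works.
    excess : ∃[ v ] 2 * χ new v < deg E v
    excess with any? (λ v → (v ∈? touched U) ×-dec (v ∈? touched E))
    ... | yes (v , v∈U , v∈E) = v , subst (λ t → 2 * t < deg E v) (sym (χ-∉ v∉new)) (vertex⇒0<deg (touched⁻ v∈E))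
      where
      v∉new : v ∉ new
      v∉new v∈new = x∈p─q⇒x∉q (touched E) (touched U) v∈new v∈U
    ... | no disjoint = v , (begin-strict
        2 * χ new v  ≤⟨ χ-≤ {p = new} (λ _ → ≤-refl) ⟩
        2            <⟨ ≤-refl ⟩
        3            ≤⟨ 3≤deg ⟩
        deg C v      ≤⟨ deg-mono C⊆E v ⟩
        deg E v      ∎)
      where
      open ≤-Reasoning
      v      = proj₁ (coil⇒branch (proj₁ irr))
      3≤deg  = proj₂ (coil⇒branch (proj₁ irr))
      -- being untouched by U spreads from the ends of e through the connected coil
      untouched : ∀ {u} → VertexOf H C u → u ∉ touched U
      untouched {u} u∈C = walk-preserves (λ w → w ∉ touched U) spread
        (proj₁ (proj₁ irr) _ _ (e , e∈C , inj₁ refl) u∈C) e-untouched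
        where
        e-untouched : proj₁ (ends e) ∉ touched U
        e-untouched y∈U = disjoint (_ , y∈U , touched⁺ (e , x∈p∧x∉q⇒x∈p─q e∈C e∉U , inj₁ refl))
        spread : ∀ {x w} → AdjIn H C x w → x ∉ touched U → w ∉ touched U
        spread (g , g∈C , g-joins) x∉U w∈U =
          disjoint (_ , w∈U , touched⁺ (g , untouched⇒C⊆E x∉U g∈C (joins-incident g-joins) , joins-incident (joins-sym g-joins)))
      C⊆E : C ⊆ E
      C⊆E {f} f∈C = x∈p∧x∉q⇒x∈p─q f∈C (λ f∈U → untouched (f , f∈C , inj₁ refl) (touched⁺ (f , f∈U , inj₁ refl)))

    few-new : ∣ new ∣ < ∣ E ∣
    few-new = *-cancelˡ-< 2 _ _ (begin-strict
      2 * ∣ new ∣              ≡⟨ cong (2 *_) (∣p∣≡∑χ new) ⟩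
      2 * sum (χ new)          ≡⟨ *-distribˡ-sum 2 (χ new) ⟩
      sum (λ v → 2 * χ new v)  <⟨ ∑-mono-< (λ v → χ-≤ new⇒2≤deg) excess ⟩
      sum (deg E)              ≡⟨ handshake E ⟩
      2 * ∣ E ∣                ∎)
      where open ≤-Reasoning

    sparse-step : Sparse U → Sparse (U ∪ C)
    sparse-step sparse-U = begin
      ∣ U ∪ C ∣ + l * ν (U ∪ C)                 ≤⟨ +-mono-≤ (≤-reflexive size-∪) (*-monoʳ-≤ l ν-∪) ⟩
      (∣ U ∣ + ∣ E ∣) + l * (ν U + ∣ new ∣)      ≡⟨ regroup (∣ U ∣) (∣ E ∣) (ν U) (∣ new ∣) l ⟩
      (∣ U ∣ + l * ν U) + (∣ E ∣ + l * ∣ new ∣)  ≤⟨ +-mono-≤ sparse-U (block-balance E≤l few-new) ⟩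
      l * ∣ U ∣ + l * ∣ E ∣                      ≡⟨ *-distribˡ-+ l (∣ U ∣) (∣ E ∣) ⟨
      l * (∣ U ∣ + ∣ E ∣)                        ≡⟨ cong (l *_) size-∪ ⟨
      l * ∣ U ∪ C ∣                              ∎
      where
      open ≤-Reasoning
      regroup : ∀ a b c d x → (a + b) + x * (c + d) ≡ (a + x * c) + (b + x * d)
      regroup = solve-∀

  coil-edges-sparse : (S : Subset m) → (∀ e → e ∈ S ⇔ (∃[ C ] (IsIrreducibleCoil H l C × e ∈ C))) → Sparse S
  coil-edges-sparse S S⇔coils = build-by-blocks Sparse S coil block sparse-∅
    (λ e∈S e∉U → Step.sparse-step (proj₁ (proj₂ (witness e∈S))) (proj₂ (proj₂ (witness e∈S))) e∉U)
    where
    witness : ∀ {e} → e ∈ S → ∃[ C ] (IsIrreducibleCoil H l C × e ∈ C)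
    witness {e} = Equivalence.to (S⇔coils e)
    coil : ∀ {e} → e ∈ S → Subset m
    coil e∈S = proj₁ (witness e∈S)
    block : ∀ {e} (e∈S : e ∈ S) → e ∈ coil e∈S × coil e∈S ⊆ S
    block e∈S = proj₂ (proj₂ (witness e∈S)) , λ {f} f∈C → Equivalence.from (S⇔coils f) (_ , proj₁ (proj₂ (witness e∈S)) , f∈C)

module Forest (H : Graph) (k : ℕ) (c : Fin (Graph.n H) → Fin k) (labelling : IsComponentLabelling H k c) where
  open Graph H
  open GraphFacts H

  root : Fin k → Fin n
  root i = proj₁ (proj₁ labelling i)

  isRoot? : ∀ v → Dec (v ≡ root (c v))
  isRoot? v = v ≟ root (c v)

  reach-root : ∀ v → Reach H ⊤ v (root (c v))
  reach-root v = Equivalence.to (proj₂ labelling v (root (c v))) (sym (proj₂ (proj₁ labelling (c v)) refl))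

  adjacent-root : ∀ {v w} → AdjIn H ⊤ v w → root (c v) ≡ root (c w)
  adjacent-root a = cong root (Equivalence.from (proj₂ labelling _ _) (step a here))

  adjacent? : ∀ v w → Dec (AdjIn H ⊤ v w)
  adjacent? v w = any? (λ e → (e ∈? ⊤) ×-dec (((proj₁ (ends e) ≟ v) ×-dec (proj₂ (ends e) ≟ w))
                                         ⊎-dec ((proj₁ (ends e) ≟ w) ×-dec (proj₂ (ends e) ≟ v))))

  Near : Fin n → ℕ → Fin n → Set
  Near r zero    v = v ≡ r
  Near r (suc j) v = Near r j v ⊎ ∃[ w ] (AdjIn H ⊤ v w × Near r j w)

  near? : ∀ r j v → Dec (Near r j v)
  near? r zero    v = v ≟ r
  near? r (suc j) v = near? r j v ⊎-dec any? (λ w → adjacent? v w ×-dec near? r j w)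

  reach⇒near : ∀ {v r} → Reach H ⊤ v r → ∃[ j ] Near r j v
  reach⇒near here          = 0 , refl
  reach⇒near (step a walk) = let (j , near) = reach⇒near walk in suc j , inj₂ (_ , a , near)

  height-witness : ∀ v → ∃[ h ] (Near (root (c v)) h v × (∀ {i} → i < h → ¬ Near (root (c v)) i v))
  height-witness v = least-witness (λ j → near? (root (c v)) j v) (proj₂ (reach⇒near (reach-root v)))

  height : Fin n → ℕ
  height v = proj₁ (height-witness v)

  record Parent (v : Fin n) : Set where
    field
      edge  : Fin m
      up    : Fin n
      joins : Joins edge v up
      lower : height up < height v

  -- Every non-root vertex has a parent: the first edge of a shortest path to the root.
  parent : ∀ {v} → v ≢ root (c v) → Parent v
  parent {v} v≢root with height-witness v in eq
  ... | zero  , v≡root , _ = ⊥-elim (v≢root v≡root)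
  ... | suc h , inj₁ near , below = ⊥-elim (below ≤-refl near)
  ... | suc h , inj₂ (w , a , near) , _ = record
    { edge = proj₁ a ; up = w ; joins = proj₂ (proj₂ a)
    ; lower = subst (height w <_) (sym (cong proj₁ eq)) (s≤s w≤h) }
    where
    w≤h : height w ≤ h
    w≤h = ≮⇒≥ (λ h<w → proj₂ (proj₂ (height-witness w)) h<w (subst (λ r → Near r h w) (adjacent-root a) near))

  -- Distinct vertices have distinct parent edges: a shared edge would make each
  -- vertex lower than the other.
  parent-injective : ∀ {v v′} (p : Parent v) (p′ : Parent v′) → Parent.edge p ≡ Parent.edge p′ → v ≡ v′
  parent-injective {v} {v′} p p′ same with v ≟ v′
  ... | yes v≡v′ = v≡v′
  ... | no v≢v′  = ⊥-elim (<-asym (below p p′ (sym same) (v≢v′ ∘ sym)) (below p′ p same v≢v′))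
    where
    -- a vertex y ≠ x on the parent edge of x is the upper end, hence lower than x
    below : ∀ {x y} (q : Parent x) (r : Parent y) → Parent.edge r ≡ Parent.edge q → y ≢ x → height y < height x
    below {x} {y} q r same y≢x with joins-endpoints (Parent.joins q) (subst (λ e → Incident H e y) same (joins-incident (Parent.joins r)))
    ... | inj₁ y≡x  = ⊥-elim (y≢x y≡x)
    ... | inj₂ y≡up = subst (λ z → height z < height x) (sym y≡up) (Parent.lower q)

  roots : Subset n
  roots = ⟦ isRoot? ⟧

  ∣roots∣≤k : ∣ roots ∣ ≤ k
  ∣roots∣≤k = ≤-trans (injection-≤ roots ⊤ (λ {v} _ → c v) (λ _ → ∈⊤) same-root) (≤-reflexive (∣⊤∣≡n k))
    where
    same-root : ∀ {v w} → v ∈ roots → w ∈ roots → c v ≡ c w → v ≡ w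
    same-root v∈ w∈ cv≡cw = trans (∈⟦⟧⁻ {P? = isRoot?} v∈) (trans (cong root cv≡cw) (sym (∈⟦⟧⁻ {P? = isRoot?} w∈)))

  -- The vertices untouched by S are the roots plus non-roots whose parent
  -- edges are distinct edges outside S.
  forest-bound : ∀ S → ∣ ∁ (touched S) ∣ ≤ k + ∣ ∁ S ∣
  forest-bound S = begin
    ∣ ∁ (touched S) ∣                         ≤⟨ ∣q∣≤∣p∪q∣ roots (∁ (touched S)) ⟩
    ∣ roots ∪ ∁ (touched S) ∣                 ≡⟨ ∣p∪q∣≡∣p∣+∣q─p∣ roots (∁ (touched S)) ⟩
    ∣ roots ∣ + ∣ ∁ (touched S) ─ roots ∣     ≤⟨ +-mono-≤ ∣roots∣≤k (injection-≤ _ (∁ S) parent-edge outside-S injective) ⟩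
    k + ∣ ∁ S ∣                               ∎
    where
    open ≤-Reasoning
    Orphan = ∁ (touched S) ─ roots
    non-root : ∀ {v} → v ∈ Orphan → v ≢ root (c v)
    non-root v∈ v≡root = x∈p─q⇒x∉q (∁ (touched S)) roots v∈ (∈⟦⟧⁺ {P? = isRoot?} v≡root)
    parent-edge : ∀ {v} → v ∈ Orphan → Fin m
    parent-edge v∈ = Parent.edge (parent (non-root v∈))
    outside-S : ∀ {v} (v∈ : v ∈ Orphan) → parent-edge v∈ ∈ ∁ S
    outside-S v∈ = x∉p⇒x∈∁p λ e∈S → x∈∁p⇒x∉p (p─q⊆p (∁ (touched S)) roots v∈)
                     (touched⁺ (_ , e∈S , joins-incident (Parent.joins (parent (non-root v∈)))))
    injective : ∀ {v w} (v∈ : v ∈ Orphan) (w∈ : w ∈ Orphan) → parent-edge v∈ ≡ parent-edge w∈ → v ≡ w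
    injective v∈ w∈ = parent-injective (parent (non-root v∈)) (parent (non-root w∈))

  excess≤cycleNumber : ∀ S → ∣ S ∣ ≤ cycleNumber H k + ν S
  excess≤cycleNumber S = +-cancelˡ-≤ n _ _ (begin
    n + ∣ S ∣                          ≡⟨ cong (_+ ∣ S ∣) (∣∁p∣+∣p∣≡n (touched S)) ⟨
    (∣ ∁ (touched S) ∣ + ν S) + ∣ S ∣  ≤⟨ +-monoˡ-≤ ∣ S ∣ (+-monoˡ-≤ (ν S) (forest-bound S)) ⟩
    ((k + ∣ ∁ S ∣) + ν S) + ∣ S ∣      ≡⟨ regroup k (∣ ∁ S ∣) (ν S) (∣ S ∣) ⟩
    (∣ ∁ S ∣ + ∣ S ∣) + k + ν S        ≡⟨ cong (λ t → t + k + ν S) (∣∁p∣+∣p∣≡n S) ⟩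
    m + k + ν S                        ≤⟨ +-monoˡ-≤ (ν S) (m≤n+m∸n (m + k) n) ⟩
    n + (m + k ∸ n) + ν S              ≡⟨ +-assoc n (m + k ∸ n) (ν S) ⟩
    n + (cycleNumber H k + ν S)        ∎)
    where
    open ≤-Reasoning
    regroup : ∀ a b c d → ((a + b) + c) + d ≡ (b + d) + a + c
    regroup = solve-∀

lemma18 : (l : ℕ) → 1 ≤ l → (H : Graph)
    → (k : ℕ) (c : Fin (Graph.n H) → Fin k) → IsComponentLabelling H k c
    → (S : Subset (Graph.m H))
    → (∀ e → e ∈ S ⇔ (∃[ C ] (IsIrreducibleCoil H l C × e ∈ C)))
    → ∣ S ∣ ≤ l * cycleNumber H k
lemma18 l _ H k c labelling S S⇔coils = +-cancelʳ-≤ (l * ν S) _ _ (begin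
  ∣ S ∣ + l * ν S                 ≤⟨ coil-edges-sparse S S⇔coils ⟩
  l * ∣ S ∣                       ≤⟨ *-monoʳ-≤ l (excess≤cycleNumber S) ⟩
  l * (cycleNumber H k + ν S)     ≡⟨ *-distribˡ-+ l (cycleNumber H k) (ν S) ⟩
  l * cycleNumber H k + l * ν S   ∎)
  where
  open GraphFacts H using (ν)
  open Growth H l using (coil-edges-sparse)
  open Forest H k c labelling using (excess≤cycleNumber)
  open ≤-Reasoning
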